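{- Let $k$ and $n$ be positive integers. Then $$c\phi_k(n)=\sum_{\ell\mid k}\overline{c\phi}_\ell\Big(\frac{n}{k/\ell}\Big)=\sum_{\ell\mid k}\overline{c\phi}_{k/\ell}\Big(\frac n\ell\Big).$$
   Context: A $k$-colored generalized Frobenius symbol is a two-row array with $d\ge 0$ columns whose entries are colored nonnegative integers $z_c$ ($z\ge 0$, color $c\in\{1,\dots,k\}$), each row strictly decreasing with respect to the total order $0_1\prec 0_2\prec\cdots\prec 0_k\prec 1_1\prec\cdots\prec 1_k\prec 2_1\prec\cdots$; it is a symbol of $n=d+\sum(\text{integer values of all entries})$, and $c\phi_k(n)$ is the number of such symbols of $n$. Let $\sigma_k=(1\,2\,\cdots\,k)$ act on colors. The order of a symbol $\lambda$ is the smallest positive integer $\ell$ such that replacing every color $c$ in $\lambda$ by $\sigma_k^\ell(c)$ (keeping the integer values) and then re-sorting each row into strictly decreasing order with respect to $\prec$ gives back $\lambda$. $\overline{c\phi}_k(n)$ denotes the number of $k$-colored generalized Frobenius symbols of $n$ of order $k$. By convention $c\phi_k(x)=\overline{c\phi}_k(x)=0$ if $x$ is not an integer. -}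

module Defs where

open import Data.Bool using (Bool; true; false; _∧_; _∨_; not; if_then_else_)
open import Data.Nat using (ℕ; zero; suc; _+_; _≡ᵇ_; _<ᵇ_; _≤_)
open import Data.Nat.DivMod using (_mod_; _/_)
open import Data.Nat.Divisibility using (_∣?_)
open import Data.Fin using (Fin; toℕ)
open import Data.List using (List; []; _∷_; map; concatMap; length; filter; upTo; allFin; applyUpTo)
open import Data.Nat.ListAction using (sum)
open import Data.Bool.ListAction using (all)
open import Data.Product using (_×_; _,_; proj₁; proj₂)
open import Relation.Nullary using (does)

-- A colored nonnegative integer z_c with k colors: value z, color c ∈ Fin k
-- (Fin index i stands for color i+1).
ColInt : ℕ → Set
ColInt k = ℕ × Fin k

_≺ᵇ_ : ∀ {k} → ColInt k → ColInt k → Bool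
(a , c) ≺ᵇ (b , d) = (a <ᵇ b) ∨ ((a ≡ᵇ b) ∧ (toℕ c <ᵇ toℕ d))

strictlyDecreasing : ∀ {k} → List (ColInt k) → Bool
strictlyDecreasing [] = true
strictlyDecreasing (x ∷ []) = true
strictlyDecreasing (x ∷ y ∷ ys) = (y ≺ᵇ x) ∧ strictlyDecreasing (y ∷ ys)

_==ᶜ_ : ∀ {k} → ColInt k → ColInt k → Bool
(a , c) ==ᶜ (b , d) = (a ≡ᵇ b) ∧ (toℕ c ≡ᵇ toℕ d)

_==ʳ_ : ∀ {k} → List (ColInt k) → List (ColInt k) → Bool
[] ==ʳ [] = true
(x ∷ xs) ==ʳ (y ∷ ys) = (x ==ᶜ y) ∧ (xs ==ʳ ys)
_ ==ʳ _ = false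

-- A k-colored generalized Frobenius symbol: two rows (top, bottom)
Symbol : ℕ → Set
Symbol k = List (ColInt k) × List (ColInt k)

rowValues : ∀ {k} → List (ColInt k) → ℕ
rowValues r = sum (map proj₁ r)

isSymbolOf : ∀ {k} → ℕ → Symbol k → Bool
isSymbolOf n (t , b) =
  strictlyDecreasing t ∧ strictlyDecreasing b ∧ (length t ≡ᵇ length b)
  ∧ ((length t + (rowValues t + rowValues b)) ≡ᵇ n)

listsUpTo : ∀ {A : Set} → List A → ℕ → List (List A)
listsUpTo as zero = [] ∷ []
listsUpTo as (suc L) = [] ∷ concatMap (λ a → map (a ∷_) (listsUpTo as L)) as

colIntsUpTo : (k n : ℕ) → List (ColInt k)
colIntsUpTo k n = concatMap (λ z → map (z ,_) (allFin k)) (upTo (suc n))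

-- All candidate symbols of n: every symbol of n has d ≤ n columns and all
-- integer values ≤ n, so every symbol of n occurs exactly once in this list.
candidates : (k n : ℕ) → List (Symbol k)
candidates k n =
  concatMap (λ t → map (t ,_) (listsUpTo (colIntsUpTo k n) n))
            (listsUpTo (colIntsUpTo k n) n)

count : ∀ {A : Set} → (A → Bool) → List A → ℕ
count p [] = 0
count p (x ∷ xs) = if p x then suc (count p xs) else count p xs

cφ : ℕ → ℕ → ℕ
cφ k n = count (isSymbolOf n) (candidates k n)

σ^ : ∀ {k} → ℕ → Fin k → Fin k
σ^ {suc k} ℓ c = (toℕ c + ℓ) mod (suc k)

insert : ∀ {k} → ColInt k → List (ColInt k) → List (ColInt k)
insert x [] = x ∷ []
insert x (y ∷ ys) = if y ≺ᵇ x then x ∷ y ∷ ys else y ∷ insert x ys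

sortRow : ∀ {k} → List (ColInt k) → List (ColInt k)
sortRow [] = []
sortRow (x ∷ xs) = insert x (sortRow xs)

recolorRow : ∀ {k} → ℕ → List (ColInt k) → List (ColInt k)
recolorRow ℓ r = sortRow (map (λ { (z , c) → (z , σ^ ℓ c) }) r)

fixedBy : ∀ {k} → ℕ → Symbol k → Bool
fixedBy ℓ (t , b) = (recolorRow ℓ t ==ʳ t) ∧ (recolorRow ℓ b ==ʳ b)

hasOrder : ∀ {k} → ℕ → Symbol k → Bool
hasOrder zero λ' = false
hasOrder (suc m) λ' = fixedBy (suc m) λ' ∧ all (λ i → not (fixedBy (suc i) λ')) (upTo m)

cφbar : ℕ → ℕ → ℕ
cφbar k n = count (λ λ' → isSymbolOf n λ' ∧ hasOrder k λ') (candidates k n)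

-- f(n / d), with the convention that it is 0 when n/d is not an integer
-- (d = 0 never occurs in the use below; it is sent to 0)
atQuot : (ℕ → ℕ) → ℕ → ℕ → ℕ
atQuot f n zero = 0
atQuot f n (suc d) = if does (suc d ∣? n) then f (n / suc d) else 0

divisorSum : ℕ → (ℕ → ℕ) → ℕ
divisorSum k g = sum (map g (filter (λ ℓ → ℓ ∣? k) (applyUpTo suc k)))

-- k / ℓ for ℓ a positive divisor (with ℓ = 0 sent to 0, never used)
quot : ℕ → ℕ → ℕ
quot k zero = 0
quot k (suc l) = k / suc l

-- Recoloring by σ^ℓ fixes a symbol exactly when each row, as a set of colored integers, is
-- invariant under σ^ℓ. Such ℓ form a subgroup of ℤ/k, so the order of a symbol is a divisor of k,
-- and grouping the symbols of n by their order gives cφ_k(n) = Σ_{ℓ∣k} #{symbols of n of order ℓ}.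
-- For ℓ ∣ k, a symbol of order ℓ is determined by its entries whose colors are among the first ℓ:
-- read modulo ℓ they form an ℓ-colored symbol of order ℓ, and conversely every entry z_e of such a
-- symbol is spread out into the k/ℓ entries z_e, z_{e+ℓ}, z_{e+2ℓ}, … . Spreading multiplies the
-- number of columns and both row sums by k/ℓ, so it is a bijection onto the k-colored symbols of n
-- of order ℓ when k/ℓ divides n, and there are no such symbols otherwise. The second equality
-- reindexes the divisor sum by ℓ ↦ k/ℓ.

module Submission where

open import Defs
open import Data.Bool using (Bool; true; false; T; not; _∧_)
open import Data.Bool.ListAction using (all; and)
open import Data.Bool.Properties using (T?; T-∧; T-∨)
open import Data.Empty using (⊥-elim)
open import Data.Fin as Fin using (Fin; toℕ; zero; suc; combine; remQuot; quotient; remainder)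
open import Data.Fin.Properties as Finₚ
  using (toℕ-injective; toℕ-fromℕ<; toℕ<n; toℕ-combine; combine-remQuot; remQuot-combine; toℕ-↑ˡ)
open import Data.List
  using (List; []; _∷_; [_]; _++_; map; filter; length; upTo; applyUpTo; allFin;
         concatMap; cartesianProduct; cartesianProductWith)
open import Data.List.Properties
  using (map-∘; map-cong; map-cong-local; map-id-local; map-++; length-map; length-++; length-tabulate; ∷-injective)
open import Data.List.Membership.Propositional using (_∈_; _∉_; find)
open import Data.List.Membership.Propositional.Properties
  using (∈-map⁺; ∈-map⁻; ∈-filter⁺; ∈-filter⁻; ∈-upTo⁺; ∈-upTo⁻; ∈-applyUpTo⁺; ∈-allFin;
         ∈-cartesianProduct⁺; ∈-cartesianProduct⁻; ∈-cartesianProductWith⁺; ∈-cartesianProductWith⁻)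
open import Data.List.Membership.Propositional.Properties.WithK using (unique∧set⇒bag)
open import Data.List.Relation.Binary.BagAndSetEquality using (∼bag⇒↭)
open import Data.List.Relation.Binary.Permutation.Propositional
  using (_↭_; ↭-refl; ↭-prep; ↭-swap; ↭-trans; ↭-sym)
open import Data.List.Relation.Binary.Permutation.Propositional.Properties using (↭-length; All-resp-↭; ∈-resp-↭)
import Data.List.Relation.Binary.Permutation.Propositional.Properties as ↭
open import Data.List.Relation.Unary.All as All using (All; []; _∷_)
open import Data.List.Relation.Unary.All.Properties using (all⁺; all⁻; ¬All⇒Any¬)
open import Data.List.Relation.Unary.AllPairs as AllPairs using (AllPairs; []; _∷_)
open import Data.List.Relation.Unary.Any using (here; there)
open import Data.List.Relation.Unary.Linked using (Linked; []; [-]; _∷_)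
open import Data.List.Relation.Unary.Linked.Properties using (Linked⇒AllPairs; AllPairs⇒Linked)
open import Data.List.Relation.Unary.Unique.Propositional using (Unique)
import Data.List.Relation.Unary.Unique.Propositional.Properties as Unique
open import Data.Nat using (ℕ; zero; suc; _+_; _*_; _<_; _≤_; _%_; _/_; _<ᵇ_; _≡ᵇ_; s≤s; NonZero)
open import Data.Nat.Properties
open import Algebra.Properties.CommutativeSemigroup +-commutativeSemigroup using (interchange)
open import Data.Nat.DivMod
  using (m≡m%n+[m/n]*n; m%n<n; [m+n]%n≡m%n; [m+kn]%n≡m%n; %-distribˡ-+; m%n%n≡m%n; m<n⇒m%n≡m;
         m*n%n≡0; n%n≡0; m∣n⇒o%n%m≡o%m; m*[n/m]≡n; m*n/n≡m; %-remove-+ˡ)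
open import Data.Nat.Divisibility using (_∣_; _∣?_; divides; m%n≡0⇒n∣m; ∣⇒≤; 0∣⇒≡0; m∣m*n)
open import Data.Nat.Induction using (<-rec)
open import Data.Nat.ListAction using (sum)
open import Data.Nat.ListAction.Properties using (sum-↭; sum-++)
open import Data.Nat.Tactic.RingSolver using (solve-∀)
open import Data.Product using (_×_; _,_; proj₁; proj₂; uncurry; ∃-syntax)
open import Data.Product.Properties using (,-injective; ,-injectiveʳ)
open import Data.Product.Relation.Binary.Lex.Strict using (×-Lex; ×-transitive; ×-irreflexive; ×-compare)
import Data.Sum as Sum
open import Data.Sum using (inj₁; inj₂)
open import Function using (_∘_; id; Equivalence; mk⇔)
open import Level using (0ℓ)
open import Relation.Binary using (Rel; Transitive; Irreflexive; tri<; tri≈; tri>)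
open import Relation.Binary.PropositionalEquality
  using (_≡_; _≢_; refl; sym; trans; cong; cong₂; subst; subst₂; resp₂; isEquivalence; module ≡-Reasoning)
open import Relation.Nullary using (¬_; yes; no; contradiction)
open import Relation.Nullary.Decidable using (dec-true; dec-false)

private variable
  A B C : Set
  xs : List A
  ys : List B

-- Counting over duplicate-free lists

count≡length-filter : (p : A → Bool) (xs : List A) → count p xs ≡ length (filter (T? ∘ p) xs)
count≡length-filter p [] = refl
count≡length-filter p (x ∷ xs) with p x
... | true  = cong suc (count≡length-filter p xs)
... | false = count≡length-filter p xs

count-∷ : (p : A → Bool) (x : A) (xs : List A) → count p (x ∷ xs) ≡ count p [ x ] + count p xs
count-∷ p x xs with p x
... | true  = refl
... | false = refl

count≡sum : (p : A → Bool) (xs : List A) → count p xs ≡ sum (map (λ x → count p [ x ]) xs)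
count≡sum p []       = refl
count≡sum p (x ∷ xs) = trans (count-∷ p x xs) (cong (count p [ x ] +_) (count≡sum p xs))

count≡0 : (p : A → Bool) (xs : List A) → (∀ x → ¬ T (p x)) → count p xs ≡ 0
count≡0 p []       none = refl
count≡0 p (x ∷ xs) none with p x | none x
... | false | _   = count≡0 p xs none
... | true  | ¬px = ⊥-elim (¬px _)

map-↭-bijection : (f : A → B) (g : B → A) → Unique xs → Unique ys →
  (∀ {x} → x ∈ xs → f x ∈ ys × g (f x) ≡ x) →
  (∀ {y} → y ∈ ys → g y ∈ xs × f (g y) ≡ y) →
  map f xs ↭ ys
map-↭-bijection {xs = xs} {ys = ys} f g xs! ys! to from =
  ∼bag⇒↭ (unique∧set⇒bag fxs! ys! (mk⇔ forth back))
  where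
  gfxs≡xs : map g (map f xs) ≡ xs
  gfxs≡xs = trans (sym (map-∘ xs)) (map-id-local (All.tabulate (proj₂ ∘ to)))
  fxs! : Unique (map f xs)
  fxs! = Unique.map⁻ {f = g} (subst Unique (sym gfxs≡xs) xs!)
  forth : ∀ {y} → y ∈ map f xs → y ∈ ys
  forth y∈ with x , x∈ , refl ← ∈-map⁻ f y∈ = proj₁ (to x∈)
  back : ∀ {y} → y ∈ ys → y ∈ map f xs
  back y∈ with gy∈ , fgy≡y ← from y∈ = subst (_∈ map f xs) fgy≡y (∈-map⁺ f gy∈)

count-bijection : (p : A → Bool) (q : B → Bool) (f : A → B) (g : B → A) → Unique xs → Unique ys →
  (∀ {x} → x ∈ xs → T (p x) → f x ∈ ys × T (q (f x)) × g (f x) ≡ x) →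
  (∀ {y} → y ∈ ys → T (q y) → g y ∈ xs × T (p (g y)) × f (g y) ≡ y) →
  count p xs ≡ count q ys
count-bijection {xs = xs} {ys = ys} p q f g xs! ys! to from = begin
  count p xs                           ≡⟨ count≡length-filter p xs ⟩
  length (filter (T? ∘ p) xs)          ≡⟨ length-map f (filter (T? ∘ p) xs) ⟨
  length (map f (filter (T? ∘ p) xs))  ≡⟨ ↭-length (map-↭-bijection f g p-xs! q-ys! to′ from′) ⟩
  length (filter (T? ∘ q) ys)          ≡⟨ count≡length-filter q ys ⟨
  count q ys                           ∎
  where
  open ≡-Reasoning
  p-xs! : Unique (filter (T? ∘ p) xs)
  p-xs! = Unique.filter⁺ (T? ∘ p) xs!
  q-ys! : Unique (filter (T? ∘ q) ys)
  q-ys! = Unique.filter⁺ (T? ∘ q) ys!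
  to′ : ∀ {x} → x ∈ filter (T? ∘ p) xs → f x ∈ filter (T? ∘ q) ys × g (f x) ≡ x
  to′ x∈ with x∈xs , px ← ∈-filter⁻ (T? ∘ p) x∈ with fx∈ , qfx , gfx≡x ← to x∈xs px =
    ∈-filter⁺ (T? ∘ q) fx∈ qfx , gfx≡x
  from′ : ∀ {y} → y ∈ filter (T? ∘ q) ys → g y ∈ filter (T? ∘ p) xs × f (g y) ≡ y
  from′ y∈ with y∈ys , qy ← ∈-filter⁻ (T? ∘ q) y∈ with gy∈ , pgy , fgy≡y ← from y∈ys qy =
    ∈-filter⁺ (T? ∘ p) gy∈ pgy , fgy≡y

count≡1 : (p : A → Bool) {o : A} → Unique xs → o ∈ xs → T (p o) → (∀ x → T (p x) → x ≡ o) →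
  count p xs ≡ 1
count≡1 p {o} xs! o∈ po unique =
  count-bijection p (λ _ → true) (λ _ → o) (λ _ → o) xs! ([] ∷ [])
    (λ {x} _ px → here refl , _ , sym (unique x px))
    (λ { (here refl) _ → o∈ , po , refl })

sum-map-+ : (f g : A → ℕ) (xs : List A) → sum (map (λ x → f x + g x) xs) ≡ sum (map f xs) + sum (map g xs)
sum-map-+ f g []       = refl
sum-map-+ f g (x ∷ xs) = trans (cong (f x + g x +_) (sum-map-+ f g xs)) (interchange (f x) (g x) _ _)

count-partition : (p : A → Bool) (label : B → A → Bool) {ls : List B} → Unique ls →
  (∀ x → T (p x) → ∃[ o ] o ∈ ls × T (label o x) × (∀ ℓ → T (label ℓ x) → ℓ ≡ o)) →
  (xs : List A) → count p xs ≡ sum (map (λ ℓ → count (λ x → p x ∧ label ℓ x) xs) ls)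
count-partition p label {ls} ls! labelled [] = sym (sum-zeros ls)
  where
  sum-zeros : (ls : List B) → sum (map (λ _ → 0) ls) ≡ 0
  sum-zeros []       = refl
  sum-zeros (_ ∷ ls) = sum-zeros ls
count-partition {A = A} {B = B} p label {ls} ls! labelled (x ∷ xs) = begin
  count p (x ∷ xs)
    ≡⟨ count-∷ p x xs ⟩
  count p [ x ] + count p xs
    ≡⟨ cong₂ _+_ (trans count-labels (count≡sum (λ ℓ → p x ∧ label ℓ x) ls))
                 (count-partition p label ls! labelled xs) ⟩
  sum (map (λ ℓ → count (p-with ℓ) [ x ]) ls) + sum (map (λ ℓ → count (p-with ℓ) xs) ls)
    ≡⟨ sum-map-+ _ _ ls ⟨
  sum (map (λ ℓ → count (p-with ℓ) [ x ] + count (p-with ℓ) xs) ls)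
    ≡⟨ cong sum (map-cong (λ ℓ → sym (count-∷ (p-with ℓ) x xs)) ls) ⟩
  sum (map (λ ℓ → count (p-with ℓ) (x ∷ xs)) ls) ∎
  where
  open ≡-Reasoning
  p-with : B → A → Bool
  p-with ℓ y = p y ∧ label ℓ y
  count-labels : count p [ x ] ≡ count (λ ℓ → p x ∧ label ℓ x) ls
  count-labels with p x in px
  ... | false = sym (count≡0 _ ls (λ _ ()))
  ... | true with o , o∈ , xo , unique ← labelled x (subst T (sym px) _) =
    sym (count≡1 (λ ℓ → label ℓ x) ls! o∈ xo unique)

sum-map-involution : (w w′ : A → ℕ) (f : A → A) → Unique xs →
  (∀ {x} → x ∈ xs → f x ∈ xs × f (f x) ≡ x) → (∀ {x} → x ∈ xs → w (f x) ≡ w′ x) →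
  sum (map w xs) ≡ sum (map w′ xs)
sum-map-involution {xs = xs} w w′ f xs! involution reweight = begin
  sum (map w xs)         ≡⟨ sum-↭ (↭.map⁺ w (map-↭-bijection f f xs! xs! involution involution)) ⟨
  sum (map w (map f xs)) ≡⟨ cong sum (map-∘ xs) ⟨
  sum (map (w ∘ f) xs)   ≡⟨ cong sum (map-cong-local (All.tabulate reweight)) ⟩
  sum (map w′ xs)        ∎
  where open ≡-Reasoning

concatMap-map≡cartesianProductWith : (f : A → B → C) (xs : List A) (ys : List B) →
  concatMap (λ x → map (f x) ys) xs ≡ cartesianProductWith f xs ys
concatMap-map≡cartesianProductWith f []       ys = refl
concatMap-map≡cartesianProductWith f (x ∷ xs) ys =
  cong (map (f x) ys ++_) (concatMap-map≡cartesianProductWith f xs ys)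

length-cartesianProduct : (xs : List A) (ys : List B) → length (cartesianProduct xs ys) ≡ length ys * length xs
length-cartesianProduct []       ys = sym (*-zeroʳ (length ys))
length-cartesianProduct (x ∷ xs) ys = begin
  length (map (x ,_) ys ++ cartesianProduct xs ys)         ≡⟨ length-++ (map (x ,_) ys) ⟩
  length (map (x ,_) ys) + length (cartesianProduct xs ys)
    ≡⟨ cong₂ _+_ (length-map (x ,_) ys) (length-cartesianProduct xs ys) ⟩
  length ys + length ys * length xs                        ≡⟨ *-suc (length ys) (length xs) ⟨
  length ys * suc (length xs)                              ∎
  where open ≡-Reasoning

sum-map-proj₁-cartesianProduct : (w : A → ℕ) (xs : List A) (ys : List B) →
  sum (map (w ∘ proj₁) (cartesianProduct xs ys)) ≡ length ys * sum (map w xs)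
sum-map-proj₁-cartesianProduct w []       ys = sym (*-zeroʳ (length ys))
sum-map-proj₁-cartesianProduct w (x ∷ xs) ys = begin
  sum (map (w ∘ proj₁) (map (x ,_) ys ++ cartesianProduct xs ys))
    ≡⟨ cong sum (map-++ (w ∘ proj₁) (map (x ,_) ys) _) ⟩
  sum (map (w ∘ proj₁) (map (x ,_) ys) ++ map (w ∘ proj₁) (cartesianProduct xs ys))
    ≡⟨ sum-++ (map (w ∘ proj₁) (map (x ,_) ys)) _ ⟩
  sum (map (w ∘ proj₁) (map (x ,_) ys)) + sum (map (w ∘ proj₁) (cartesianProduct xs ys))
    ≡⟨ cong₂ _+_ (row ys) (sum-map-proj₁-cartesianProduct w xs ys) ⟩
  length ys * w x + length ys * sum (map w xs)
    ≡⟨ *-distribˡ-+ (length ys) (w x) _ ⟨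
  length ys * sum (map w (x ∷ xs)) ∎
  where
  open ≡-Reasoning
  row : ∀ ys → sum (map (w ∘ proj₁) (map (x ,_) ys)) ≡ length ys * w x
  row []       = refl
  row (_ ∷ ys) = cong (w x +_) (row ys)

module _ {A : Set} {_<_ : Rel A 0ℓ} (<-trans : Transitive _<_) (<-irrefl : Irreflexive _≡_ _<_) where

  AllPairs-≡ : ∀ {xs ys : List A} → AllPairs _<_ xs → AllPairs _<_ ys →
    (∀ {z} → z ∈ xs → z ∈ ys) → (∀ {z} → z ∈ ys → z ∈ xs) → xs ≡ ys
  AllPairs-≡ [] [] _ _ = refl
  AllPairs-≡ [] (_ ∷ _) _ ys⊆ with () ← ys⊆ (here refl)
  AllPairs-≡ (_ ∷ _) [] xs⊆ _ with () ← xs⊆ (here refl)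
  AllPairs-≡ {x ∷ xs} {y ∷ ys} (x<xs ∷ xs<) (y<ys ∷ ys<) xs⊆ ys⊆ =
    cong₂ _∷_ x≡y (AllPairs-≡ xs< ys< tail⊆ tail⊇)
    where
    x≡y : x ≡ y
    x≡y with xs⊆ (here refl) | ys⊆ (here refl)
    ... | here x≡y   | _          = x≡y
    ... | there _    | here y≡x   = sym y≡x
    ... | there x∈ys | there y∈xs =
      contradiction (<-trans (All.lookup x<xs y∈xs) (All.lookup y<ys x∈ys)) (<-irrefl refl)
    tail⊆ : ∀ {z} → z ∈ xs → z ∈ ys
    tail⊆ z∈ with xs⊆ (there z∈)
    ... | here refl  = contradiction (subst (_< y) x≡y (All.lookup x<xs z∈)) (<-irrefl refl)
    ... | there z∈ys = z∈ys
    tail⊇ : ∀ {z} → z ∈ ys → z ∈ xs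
    tail⊇ z∈ with ys⊆ (there z∈)
    ... | here refl  = contradiction (subst (_< x) (sym x≡y) (All.lookup y<ys z∈)) (<-irrefl refl)
    ... | there z∈xs = z∈xs

-- Least positive solutions of a Boolean predicate

T-extensional : ∀ {a b} → (T a → T b) → (T b → T a) → a ≡ b
T-extensional {false} {false} _   _   = refl
T-extensional {false} {true}  _   b⇒a with () ← b⇒a _
T-extensional {true}  {false} a⇒b _   with () ← a⇒b _
T-extensional {true}  {true}  _   _   = refl

private
  T-not⇒¬T : ∀ {b} → T (not b) → ¬ T b
  T-not⇒¬T {false} _ ()

  ¬T-not⇒T : ∀ {b} → ¬ T (not b) → T b
  ¬T-not⇒T {false} ¬t = ¬t _
  ¬T-not⇒T {true}  _  = _

isLeastPositive : (ℕ → Bool) → ℕ → Bool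
isLeastPositive F zero    = false
isLeastPositive F (suc m) = F (suc m) ∧ all (λ i → not (F (suc i))) (upTo m)

module _ {F : ℕ → Bool} where

  isLeastPositive⇒ : ∀ {m} → T (isLeastPositive F (suc m)) →
    T (F (suc m)) × (∀ {i} → i < m → ¬ T (F (suc i)))
  isLeastPositive⇒ {m} least with Fm , noSmaller ← Equivalence.to T-∧ least =
    Fm , λ i<m → T-not⇒¬T (All.lookup (all⁺ _ (upTo m) noSmaller) (∈-upTo⁺ i<m))

  isLeastPositive-unique : ∀ {ℓ ℓ′} → T (isLeastPositive F ℓ) → T (isLeastPositive F ℓ′) → ℓ ≡ ℓ′
  isLeastPositive-unique {suc m} {suc m′} least least′
    with Fm , below ← isLeastPositive⇒ least | Fm′ , below′ ← isLeastPositive⇒ least′ with <-cmp m m′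
  ... | tri< m<m′ _ _ = contradiction Fm (below′ m<m′)
  ... | tri≈ _ refl _ = refl
  ... | tri> _ _ m>m′ = contradiction Fm′ (below m>m′)

  isLeastPositive-exists : ∀ m → T (F (suc m)) → ∃[ ℓ ] ℓ ≤ suc m × T (isLeastPositive F ℓ)
  isLeastPositive-exists = <-rec _ go
    where
    go : ∀ m → (∀ {i} → i < m → T (F (suc i)) → ∃[ ℓ ] ℓ ≤ suc i × T (isLeastPositive F ℓ)) →
         T (F (suc m)) → ∃[ ℓ ] ℓ ≤ suc m × T (isLeastPositive F ℓ)
    go m rec Fm with T? (all (λ i → not (F (suc i))) (upTo m))
    ... | yes noSmaller = suc m , ≤-refl , Equivalence.from T-∧ (Fm , noSmaller)
    ... | no smaller with i , i∈ , ¬¬Fi ← find (¬All⇒Any¬ (T? ∘ _) (upTo m) (smaller ∘ all⁻ _))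
                     with ℓ , ℓ≤ , least ← rec (∈-upTo⁻ i∈) (¬T-not⇒T ¬¬Fi) =
      ℓ , ≤-trans ℓ≤ (m≤n⇒m≤1+n (∈-upTo⁻ i∈)) , least

  isLeastPositive-cong : ∀ {G} → (∀ i → F i ≡ G i) → ∀ ℓ → isLeastPositive F ℓ ≡ isLeastPositive G ℓ
  isLeastPositive-cong F≗G zero    = refl
  isLeastPositive-cong F≗G (suc m) =
    cong₂ _∧_ (F≗G (suc m)) (cong and (map-cong (λ i → cong not (F≗G (suc i))) (upTo m)))

  -- K % o ≡ (K / o) * k′ * o (mod K) lies in the set and is smaller than o, so it is 0.
  isLeastPositive-∣ : ∀ {o} k′ →
    T (F 0) → (∀ {a b} → T (F a) → T (F b) → T (F (a + b))) →
    (∀ {a b} → a % suc k′ ≡ b % suc k′ → T (F a) → T (F b)) →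
    T (isLeastPositive F o) → o ∣ suc k′
  isLeastPositive-∣ {suc m} k′ F0 F-+ F-% least = m%n≡0⇒n∣m K o r≡0
    where
    K o r q : ℕ
    K = suc k′
    o = suc m
    r = K % o
    q = K / o
    F-multiple : ∀ j → T (F (j * o))
    F-multiple zero    = F0
    F-multiple (suc j) = F-+ (proj₁ (isLeastPositive⇒ least)) (F-multiple j)
    q*k′*o≡r : (q * k′ * o) % K ≡ r % K
    q*k′*o≡r = begin
      (q * k′ * o) % K               ≡⟨ [m+n]%n≡m%n (q * k′ * o) K ⟨
      (q * k′ * o + K) % K           ≡⟨ cong (λ x → (q * k′ * o + x) % K) (m≡m%n+[m/n]*n K o) ⟩
      (q * k′ * o + (r + q * o)) % K ≡⟨ cong (_% K) (rearrange q k′ o r) ⟩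
      (r + q * o * K) % K            ≡⟨ [m+kn]%n≡m%n r (q * o) K ⟩
      r % K                          ∎
      where
      open ≡-Reasoning
      rearrange : ∀ q k′ o r → q * k′ * o + (r + q * o) ≡ r + q * o * suc k′
      rearrange = solve-∀
    r≡0 : r ≡ 0
    r≡0 with r in r≡suc | m%n<n K o
    ... | zero   | _   = refl
    ... | suc r′ | r<o = contradiction (F-% (trans q*k′*o≡r (cong (_% K) r≡suc)) (F-multiple (q * k′)))
                                       (proj₂ (isLeastPositive⇒ least) (≤-pred r<o))

-- Strictly decreasing rows

module _ {k : ℕ} where

  _≺_ _≻_ : Rel (ColInt k) 0ℓ
  _≺_ = ×-Lex _≡_ _<_ Fin._<_
  x ≻ y = y ≺ x

  ≺ᵇ⇒≺ : ∀ {x y} → T (x ≺ᵇ y) → x ≺ y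
  ≺ᵇ⇒≺ {a , c} {b , d} = Sum.map (<ᵇ⇒< a b) same-value ∘ Equivalence.to T-∨
    where
    same-value : T ((a ≡ᵇ b) ∧ (toℕ c <ᵇ toℕ d)) → a ≡ b × toℕ c < toℕ d
    same-value t = let a≡b , c<d = Equivalence.to T-∧ t in ≡ᵇ⇒≡ a b a≡b , <ᵇ⇒< (toℕ c) (toℕ d) c<d

  ≺⇒≺ᵇ : ∀ {x y} → x ≺ y → T (x ≺ᵇ y)
  ≺⇒≺ᵇ {a , c} {b , d} = Equivalence.from T-∨ ∘ Sum.map <⇒<ᵇ same-value
    where
    same-value : a ≡ b × toℕ c < toℕ d → T ((a ≡ᵇ b) ∧ (toℕ c <ᵇ toℕ d))
    same-value (refl , c<d) = Equivalence.from T-∧ (≡⇒≡ᵇ a a refl , <⇒<ᵇ c<d)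

  ≺-trans : Transitive _≺_
  ≺-trans = ×-transitive {_<₂_ = Fin._<_} isEquivalence (resp₂ _<_) <-trans (Finₚ.<-trans {n = k})

  ≺-irrefl : Irreflexive _≡_ _≺_
  ≺-irrefl refl = ×-irreflexive {_≈₁_ = _≡_} {_<₁_ = _<_} {_≈₂_ = _≡_} {_<₂_ = Fin._<_}
                                 <-irrefl (Finₚ.<-irrefl {n = k}) (refl , refl)

  ≺-connex : ∀ {x y} → x ≢ y → ¬ y ≺ x → x ≺ y
  ≺-connex {x} {y} x≢y y⊀x with ×-compare sym <-cmp Finₚ.<-cmp x y
  ... | tri< x≺y _ _           = x≺y
  ... | tri≈ _ (refl , refl) _ = contradiction refl x≢y
  ... | tri> _ _ y≺x           = contradiction y≺x y⊀x

  ≻-trans : Transitive _≻_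
  ≻-trans x≻y y≻z = ≺-trans y≻z x≻y

  Decreasing : List (ColInt k) → Set
  Decreasing = AllPairs _≻_

  strictlyDecreasing⇒Decreasing : ∀ (r : List (ColInt k)) → T (strictlyDecreasing r) → Decreasing r
  strictlyDecreasing⇒Decreasing r = Linked⇒AllPairs ≻-trans ∘ linked r
    where
    linked : ∀ (r : List (ColInt k)) → T (strictlyDecreasing r) → Linked _≻_ r
    linked []           _ = []
    linked (_ ∷ [])     _ = [-]
    linked (x ∷ y ∷ ys) t = ≺ᵇ⇒≺ (proj₁ y≺x,rest) ∷ linked (y ∷ ys) (proj₂ y≺x,rest)
      where
      y≺x,rest : T (y ≺ᵇ x) × T (strictlyDecreasing (y ∷ ys))
      y≺x,rest = Equivalence.to (T-∧ {y ≺ᵇ x}) t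

  Decreasing⇒strictlyDecreasing : ∀ {r} → Decreasing r → T (strictlyDecreasing r)
  Decreasing⇒strictlyDecreasing = unlinked ∘ AllPairs⇒Linked
    where
    unlinked : ∀ {r} → Linked _≻_ r → T (strictlyDecreasing r)
    unlinked []           = _
    unlinked [-]          = _
    unlinked (y≺x ∷ rest) = Equivalence.from T-∧ (≺⇒≺ᵇ y≺x , unlinked rest)

  Decreasing⇒Unique : ∀ {r} → Decreasing r → Unique r
  Decreasing⇒Unique = AllPairs.map (λ y≺x x≡y → ≺-irrefl (sym x≡y) y≺x)

  Decreasing-≡ : ∀ {r s} → Decreasing r → Decreasing s →
    (∀ {x} → x ∈ r → x ∈ s) → (∀ {x} → x ∈ s → x ∈ r) → r ≡ s
  Decreasing-≡ = AllPairs-≡ ≻-trans (λ x≡y → ≺-irrefl (sym x≡y))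

  insert-↭ : ∀ (x : ColInt k) r → insert x r ↭ x ∷ r
  insert-↭ x [] = ↭-refl
  insert-↭ x (y ∷ ys) with y ≺ᵇ x
  ... | true  = ↭-refl
  ... | false = ↭-trans (↭-prep y (insert-↭ x ys)) (↭-swap y x ↭-refl)

  sortRow-↭ : ∀ (r : List (ColInt k)) → sortRow r ↭ r
  sortRow-↭ []      = ↭-refl
  sortRow-↭ (x ∷ r) = ↭-trans (insert-↭ x (sortRow r)) (↭-prep x (sortRow-↭ r))

  insert-Decreasing : ∀ (x : ColInt k) {r} → x ∉ r → Decreasing r → Decreasing (insert x r)
  insert-Decreasing x {[]} _ [] = [] ∷ []
  insert-Decreasing x {y ∷ ys} x∉ (y≻ys ∷ ys↓) with y ≺ᵇ x in y≺ᵇx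
  ... | true  = (y≺x ∷ All.map (λ z≺y → ≺-trans z≺y y≺x) y≻ys) ∷ y≻ys ∷ ys↓
    where
    y≺x : y ≺ x
    y≺x = ≺ᵇ⇒≺ (subst T (sym y≺ᵇx) _)
  ... | false = All-resp-↭ (↭-sym (insert-↭ x ys)) (x≺y ∷ y≻ys) ∷ insert-Decreasing x (x∉ ∘ there) ys↓
    where
    x≺y : x ≺ y
    x≺y = ≺-connex (x∉ ∘ here) (λ y≺x → subst T y≺ᵇx (≺⇒≺ᵇ y≺x))

  sortRow-Decreasing : ∀ {r : List (ColInt k)} → Unique r → Decreasing (sortRow r)
  sortRow-Decreasing {[]}    []          = []
  sortRow-Decreasing {x ∷ r} (x∉r ∷ r!) =
    insert-Decreasing x (λ x∈ → All.lookup x∉r (∈-resp-↭ (sortRow-↭ r) x∈) refl) (sortRow-Decreasing r!)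

  ==ʳ⇒≡ : ∀ (r s : List (ColInt k)) → T (r ==ʳ s) → r ≡ s
  ==ʳ⇒≡ []            []            _ = refl
  ==ʳ⇒≡ ((a , c) ∷ r) ((b , d) ∷ s) t
    with heads , tails ← Equivalence.to (T-∧ {(a , c) ==ᶜ (b , d)}) t
    with a≡ᵇb , c≡ᵇd ← Equivalence.to (T-∧ {a ≡ᵇ b}) heads
    with refl ← ≡ᵇ⇒≡ a b a≡ᵇb | refl ← toℕ-injective (≡ᵇ⇒≡ (toℕ c) (toℕ d) c≡ᵇd)
    = cong ((a , c) ∷_) (==ʳ⇒≡ r s tails)

  ==ʳ-refl : ∀ (r : List (ColInt k)) → T (r ==ʳ r)
  ==ʳ-refl []            = _
  ==ʳ-refl ((a , c) ∷ r) =
    Equivalence.from T-∧ (Equivalence.from T-∧ (≡⇒≡ᵇ a a refl , ≡⇒≡ᵇ (toℕ c) (toℕ c) refl) ,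
                          ==ʳ-refl r)

  rowValues-↭ : ∀ {r s : List (ColInt k)} → r ↭ s → rowValues r ≡ rowValues s
  rowValues-↭ = sum-↭ ∘ ↭.map⁺ proj₁

-- Recoloring

%-absorbˡ : ∀ m k n .{{_ : NonZero n}} → (m % n + k) % n ≡ (m + k) % n
%-absorbˡ m k n = begin
  (m % n + k) % n           ≡⟨ %-distribˡ-+ (m % n) k n ⟩
  (m % n % n + k % n) % n   ≡⟨ cong (λ x → (x + k % n) % n) (m%n%n≡m%n m n) ⟩
  (m % n + k % n) % n       ≡⟨ %-distribˡ-+ m k n ⟨
  (m + k) % n               ∎
  where open ≡-Reasoning

recolor : ∀ {k} → ℕ → ColInt k → ColInt k
recolor ℓ (z , c) = z , σ^ ℓ c

Invariant : ∀ {k} → ℕ → List (ColInt k) → Set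
Invariant ℓ r = ∀ {x} → x ∈ r → recolor ℓ x ∈ r

module _ {k′ : ℕ} where
  private
    K = suc k′

  toℕ-σ^ : ∀ ℓ (c : Fin K) → toℕ (σ^ ℓ c) ≡ (toℕ c + ℓ) % K
  toℕ-σ^ ℓ c = toℕ-fromℕ< _

  σ^-cong : ∀ {a b} → a % K ≡ b % K → (c : Fin K) → σ^ a c ≡ σ^ b c
  σ^-cong {a} {b} a≡b c = toℕ-injective (begin
    toℕ (σ^ a c)                ≡⟨ toℕ-σ^ a c ⟩
    (toℕ c + a) % K             ≡⟨ %-distribˡ-+ (toℕ c) a K ⟩
    (toℕ c % K + a % K) % K     ≡⟨ cong (λ x → (toℕ c % K + x) % K) a≡b ⟩
    (toℕ c % K + b % K) % K     ≡⟨ %-distribˡ-+ (toℕ c) b K ⟨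
    (toℕ c + b) % K             ≡⟨ toℕ-σ^ b c ⟨
    toℕ (σ^ b c)                ∎)
    where open ≡-Reasoning

  σ^-∘ : ∀ a b (c : Fin K) → σ^ a (σ^ b c) ≡ σ^ (b + a) c
  σ^-∘ a b c = toℕ-injective (begin
    toℕ (σ^ a (σ^ b c))         ≡⟨ toℕ-σ^ a (σ^ b c) ⟩
    (toℕ (σ^ b c) + a) % K      ≡⟨ cong (λ x → (x + a) % K) (toℕ-σ^ b c) ⟩
    ((toℕ c + b) % K + a) % K   ≡⟨ %-absorbˡ (toℕ c + b) a K ⟩
    (toℕ c + b + a) % K         ≡⟨ cong (_% K) (+-assoc (toℕ c) b a) ⟩
    (toℕ c + (b + a)) % K       ≡⟨ toℕ-σ^ (b + a) c ⟨
    toℕ (σ^ (b + a) c)          ∎)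
    where open ≡-Reasoning

  σ^-0 : (c : Fin K) → σ^ 0 c ≡ c
  σ^-0 c = toℕ-injective (begin
    toℕ (σ^ 0 c)    ≡⟨ toℕ-σ^ 0 c ⟩
    (toℕ c + 0) % K ≡⟨ cong (_% K) (+-identityʳ (toℕ c)) ⟩
    toℕ c % K       ≡⟨ m<n⇒m%n≡m (toℕ<n c) ⟩
    toℕ c           ∎)
    where open ≡-Reasoning

  recolor-∘ : ∀ a b (x : ColInt K) → recolor a (recolor b x) ≡ recolor (b + a) x
  recolor-∘ a b (z , c) = cong (z ,_) (σ^-∘ a b c)

  recolor-cong : ∀ {a b} → a % K ≡ b % K → (x : ColInt K) → recolor a x ≡ recolor b x
  recolor-cong a≡b (z , c) = cong (z ,_) (σ^-cong a≡b c)

  recolor-0 : (x : ColInt K) → recolor 0 x ≡ x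
  recolor-0 (z , c) = cong (z ,_) (σ^-0 c)

  recolor-*K : ∀ j (x : ColInt K) → recolor (j * K) x ≡ x
  recolor-*K j x = trans (recolor-cong (m*n%n≡0 j K) x) (recolor-0 x)

  recolor-inverseˡ : ∀ ℓ (x : ColInt K) → recolor (ℓ * k′) (recolor ℓ x) ≡ x
  recolor-inverseˡ ℓ x = begin
    recolor (ℓ * k′) (recolor ℓ x) ≡⟨ recolor-∘ (ℓ * k′) ℓ x ⟩
    recolor (ℓ + ℓ * k′) x         ≡⟨ cong (λ a → recolor a x) (*-suc ℓ k′) ⟨
    recolor (ℓ * K) x              ≡⟨ recolor-*K ℓ x ⟩
    x                              ∎
    where open ≡-Reasoning

  recolor-inverseʳ : ∀ ℓ (x : ColInt K) → recolor ℓ (recolor (ℓ * k′) x) ≡ x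
  recolor-inverseʳ ℓ x = begin
    recolor ℓ (recolor (ℓ * k′) x) ≡⟨ recolor-∘ ℓ (ℓ * k′) x ⟩
    recolor (ℓ * k′ + ℓ) x         ≡⟨ cong (λ a → recolor a x) (+-comm (ℓ * k′) ℓ) ⟩
    recolor (ℓ + ℓ * k′) x         ≡⟨ cong (λ a → recolor a x) (*-suc ℓ k′) ⟨
    recolor (ℓ * K) x              ≡⟨ recolor-*K ℓ x ⟩
    x                              ∎
    where open ≡-Reasoning

  recolor-injective : ∀ ℓ {x y : ColInt K} → recolor ℓ x ≡ recolor ℓ y → x ≡ y
  recolor-injective ℓ {x} {y} eq =
    trans (sym (recolor-inverseˡ ℓ x)) (trans (cong (recolor (ℓ * k′)) eq) (recolor-inverseˡ ℓ y))

  Invariant-0 : (r : List (ColInt K)) → Invariant 0 r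
  Invariant-0 r {x} x∈ = subst (_∈ r) (sym (recolor-0 x)) x∈

  Invariant-+ : ∀ {a b} {r : List (ColInt K)} → Invariant a r → Invariant b r → Invariant (a + b) r
  Invariant-+ {a} {b} {r} inv-a inv-b {x} x∈ = subst (_∈ r) (recolor-∘ b a x) (inv-b (inv-a x∈))

  Invariant-* : ∀ j {a} {r : List (ColInt K)} → Invariant a r → Invariant (j * a) r
  Invariant-* zero    inv = Invariant-0 _
  Invariant-* (suc j) inv = Invariant-+ inv (Invariant-* j inv)

  Invariant-cong : ∀ {a b} {r : List (ColInt K)} → a % K ≡ b % K → Invariant a r → Invariant b r
  Invariant-cong {r = r} a≡b inv {x} x∈ = subst (_∈ r) (recolor-cong a≡b x) (inv x∈)

  fixed⇒Invariant : ∀ ℓ (r : List (ColInt K)) → T (recolorRow ℓ r ==ʳ r) → Invariant ℓ r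
  fixed⇒Invariant ℓ r fixed {x} x∈ =
    subst (recolor ℓ x ∈_) (==ʳ⇒≡ _ r fixed) (∈-resp-↭ (↭-sym (sortRow-↭ _)) (∈-map⁺ (recolor ℓ) x∈))

  Invariant⇒fixed : ∀ ℓ {r : List (ColInt K)} → Decreasing r → Invariant ℓ r → T (recolorRow ℓ r ==ʳ r)
  Invariant⇒fixed ℓ {r} r↓ inv = subst (λ s → T (s ==ʳ r)) (sym recolored≡r) (==ʳ-refl r)
    where
    recolored! : Unique (map (recolor ℓ) r)
    recolored! = Unique.map⁺ (recolor-injective ℓ) (Decreasing⇒Unique r↓)
    ⊆r : ∀ {y} → y ∈ sortRow (map (recolor ℓ) r) → y ∈ r
    ⊆r y∈ with x , x∈ , refl ← ∈-map⁻ (recolor ℓ) (∈-resp-↭ (sortRow-↭ _) y∈) = inv x∈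
    ⊇r : ∀ {y} → y ∈ r → y ∈ sortRow (map (recolor ℓ) r)
    ⊇r {y} y∈ = ∈-resp-↭ (↭-sym (sortRow-↭ _))
      (subst (_∈ map (recolor ℓ) r) (recolor-inverseʳ ℓ y)
        (∈-map⁺ (recolor ℓ) (subst (λ a → Invariant a r) (*-comm k′ ℓ) (Invariant-* k′ inv) y∈)))
    recolored≡r : recolorRow ℓ r ≡ r
    recolored≡r = Decreasing-≡ (sortRow-Decreasing recolored!) r↓ ⊆r ⊇r

-- Symbols, candidates and orders

size : ∀ {k} → Symbol k → ℕ
size (t , b) = length t + (rowValues t + rowValues b)

record IsSymbol {k} (n : ℕ) (s : Symbol k) : Set where
  field
    top↓    : Decreasing (proj₁ s)
    bottom↓ : Decreasing (proj₂ s)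
    columns : length (proj₁ s) ≡ length (proj₂ s)
    size≡   : size s ≡ n

isSymbolOf⇒IsSymbol : ∀ {k} {n} (s : Symbol k) → T (isSymbolOf n s) → IsSymbol n s
isSymbolOf⇒IsSymbol {n = n} (t , b) symbol
  with t↓ , rest ← Equivalence.to (T-∧ {strictlyDecreasing t}) symbol
  with b↓ , rest ← Equivalence.to (T-∧ {strictlyDecreasing b}) rest
  with columns , size≡ ← Equivalence.to (T-∧ {length t ≡ᵇ length b}) rest = record
    { top↓    = strictlyDecreasing⇒Decreasing t t↓
    ; bottom↓ = strictlyDecreasing⇒Decreasing b b↓
    ; columns = ≡ᵇ⇒≡ _ _ columns
    ; size≡   = ≡ᵇ⇒≡ _ n size≡
    }

IsSymbol⇒isSymbolOf : ∀ {k} {n} {s : Symbol k} → IsSymbol n s → T (isSymbolOf n s)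
IsSymbol⇒isSymbolOf {n = n} {t , b} symbol =
  Equivalence.from T-∧ (Decreasing⇒strictlyDecreasing top↓ ,
  Equivalence.from T-∧ (Decreasing⇒strictlyDecreasing bottom↓ ,
  Equivalence.from T-∧ (≡⇒≡ᵇ _ _ columns , ≡⇒≡ᵇ _ n size≡)))
  where open IsSymbol symbol

symbolOfOrder : ∀ {k} → ℕ → ℕ → Symbol k → Bool
symbolOfOrder n ℓ s = isSymbolOf n s ∧ hasOrder ℓ s

symbolOfOrder⇒ : ∀ {k n ℓ} (s : Symbol k) → T (symbolOfOrder n ℓ s) → IsSymbol n s × T (hasOrder ℓ s)
symbolOfOrder⇒ s t = let symbol , order = Equivalence.to T-∧ t in isSymbolOf⇒IsSymbol s symbol , order

symbolOfOrder⇐ : ∀ {k n ℓ} {s : Symbol k} → IsSymbol n s → T (hasOrder ℓ s) → T (symbolOfOrder n ℓ s)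
symbolOfOrder⇐ symbol order = Equivalence.from T-∧ (IsSymbol⇒isSymbolOf symbol , order)

listsUpTo-unique : ∀ {as : List A} L → Unique as → Unique (listsUpTo as L)
listsUpTo-unique zero    as! = [] ∷ []
listsUpTo-unique {as = as} (suc L) as! =
  subst (λ l → Unique ([] ∷ l)) (sym (concatMap-map≡cartesianProductWith _∷_ as (listsUpTo as L)))
  (All.tabulate nonempty ∷ Unique.cartesianProductWith⁺ _∷_ ∷-injective as! (listsUpTo-unique L as!))
  where
  nonempty : ∀ {x} → x ∈ cartesianProductWith _∷_ as (listsUpTo as L) → [] ≢ x
  nonempty x∈ with _ , _ , _ , _ , refl ← ∈-cartesianProductWith⁻ _∷_ as (listsUpTo as L) x∈ = λ ()

∈-listsUpTo : ∀ {as : List A} L {x : List A} → length x ≤ L → All (_∈ as) x → x ∈ listsUpTo as L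
∈-listsUpTo zero    {[]}    _         _           = here refl
∈-listsUpTo (suc L) {[]}    _         _           = here refl
∈-listsUpTo {as = as} (suc L) {y ∷ ys} (s≤s ys≤L) (y∈ ∷ ys∈) =
  there (subst (y ∷ ys ∈_) (sym (concatMap-map≡cartesianProductWith _∷_ as (listsUpTo as L)))
    (∈-cartesianProductWith⁺ _∷_ y∈ (∈-listsUpTo L ys≤L ys∈)))

colIntsUpTo-unique : ∀ k n → Unique (colIntsUpTo k n)
colIntsUpTo-unique k n = subst Unique (sym (concatMap-map≡cartesianProductWith _,_ (upTo (suc n)) (allFin k)))
  (Unique.cartesianProduct⁺ (Unique.upTo⁺ (suc n)) (Unique.allFin⁺ k))

∈-colIntsUpTo : ∀ {k n} {x : ColInt k} → proj₁ x ≤ n → x ∈ colIntsUpTo k n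
∈-colIntsUpTo {k} {n} {z , c} z≤ =
  subst ((z , c) ∈_) (sym (concatMap-map≡cartesianProductWith _,_ (upTo (suc n)) (allFin k)))
  (∈-cartesianProduct⁺ (∈-upTo⁺ (s≤s z≤)) (∈-allFin c))

candidates-unique : ∀ k n → Unique (candidates k n)
candidates-unique k n = subst Unique (sym (concatMap-map≡cartesianProductWith _,_ rows rows))
  (Unique.cartesianProduct⁺ rows! rows!)
  where
  rows : List (List (ColInt k))
  rows = listsUpTo (colIntsUpTo k n) n
  rows! : Unique rows
  rows! = listsUpTo-unique n (colIntsUpTo-unique k n)

value≤rowValues : ∀ {k} {r : List (ColInt k)} {x} → x ∈ r → proj₁ x ≤ rowValues r
value≤rowValues (here refl) = m≤m+n _ _
value≤rowValues (there x∈) = ≤-trans (value≤rowValues x∈) (m≤n+m _ _)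

IsSymbol⇒∈candidates : ∀ {k n} {s : Symbol k} → IsSymbol n s → s ∈ candidates k n
IsSymbol⇒∈candidates {k} {n} {t , b} symbol =
  subst ((t , b) ∈_) (sym (concatMap-map≡cartesianProductWith _,_ rows rows))
  (∈-cartesianProduct⁺ (∈-listsUpTo n t-length (row∈ t-values)) (∈-listsUpTo n b-length (row∈ b-values)))
  where
  open IsSymbol symbol
  rows : List (List (ColInt k))
  rows = listsUpTo (colIntsUpTo k n) n
  row∈ : ∀ {r} → rowValues r ≤ n → All (_∈ colIntsUpTo k n) r
  row∈ r≤n = All.tabulate (λ x∈ → ∈-colIntsUpTo (≤-trans (value≤rowValues x∈) r≤n))
  values≤n : rowValues t + rowValues b ≤ n
  values≤n = subst (_ ≤_) size≡ (m≤n+m _ (length t))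
  t-length : length t ≤ n
  t-length = subst (length t ≤_) size≡ (m≤m+n _ _)
  b-length : length b ≤ n
  b-length = subst (_≤ n) columns t-length
  t-values : rowValues t ≤ n
  t-values = ≤-trans (m≤m+n _ _) values≤n
  b-values : rowValues b ≤ n
  b-values = ≤-trans (m≤n+m _ _) values≤n

divisors : ℕ → List ℕ
divisors k = filter (_∣? k) (applyUpTo suc k)

divisors-unique : ∀ k → Unique (divisors k)
divisors-unique k = Unique.filter⁺ (_∣? k) (Unique.applyUpTo⁺₁ suc k (λ i<j _ → <⇒≢ i<j ∘ suc-injective))

∈-divisors⁻ : ∀ {k ℓ} → ℓ ∈ divisors k → ℓ ∣ k
∈-divisors⁻ {k} = proj₂ ∘ ∈-filter⁻ (_∣? k) {xs = applyUpTo suc k}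

∈-divisors⁺ : ∀ {k′ ℓ} → ℓ ∣ suc k′ → ℓ ∈ divisors (suc k′)
∈-divisors⁺ {k′} {zero}  0∣K with () ← 0∣⇒≡0 0∣K
∈-divisors⁺ {k′} {suc i} ℓ∣K = ∈-filter⁺ (_∣? suc k′) (∈-applyUpTo⁺ suc (∣⇒≤ ℓ∣K)) ℓ∣K

hasOrder≡isLeastPositive : ∀ {k} ℓ (s : Symbol k) → hasOrder ℓ s ≡ isLeastPositive (λ i → fixedBy i s) ℓ
hasOrder≡isLeastPositive zero    s = refl
hasOrder≡isLeastPositive (suc m) s = refl

order-unique : ∀ {k} {ℓ ℓ′} (s : Symbol k) → T (hasOrder ℓ s) → T (hasOrder ℓ′ s) → ℓ ≡ ℓ′
order-unique {ℓ = ℓ} {ℓ′} s order order′ = isLeastPositive-unique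
  (subst T (hasOrder≡isLeastPositive ℓ s) order) (subst T (hasOrder≡isLeastPositive ℓ′ s) order′)

hasOrder⇒fixedBy : ∀ {k} ℓ (s : Symbol k) → T (hasOrder ℓ s) → T (fixedBy ℓ s)
hasOrder⇒fixedBy (suc m) s order = proj₁ (isLeastPositive⇒ {F = λ i → fixedBy i s} order)

module _ {k′ : ℕ} {t b : List (ColInt (suc k′))} (t↓ : Decreasing t) (b↓ : Decreasing b) where

  fixedBy⇒Invariant : ∀ {ℓ} → T (fixedBy ℓ (t , b)) → Invariant ℓ t × Invariant ℓ b
  fixedBy⇒Invariant {ℓ} fixed with t-fixed , b-fixed ← Equivalence.to (T-∧ {recolorRow ℓ t ==ʳ t}) fixed =
    fixed⇒Invariant ℓ t t-fixed , fixed⇒Invariant ℓ b b-fixed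

  Invariant⇒fixedBy : ∀ {ℓ} → Invariant ℓ t → Invariant ℓ b → T (fixedBy ℓ (t , b))
  Invariant⇒fixedBy {ℓ} t-inv b-inv =
    Equivalence.from T-∧ (Invariant⇒fixed ℓ t↓ t-inv , Invariant⇒fixed ℓ b↓ b-inv)

  order-∣ : ∀ {ℓ} → T (hasOrder ℓ (t , b)) → ℓ ∣ suc k′
  order-∣ {ℓ} order = isLeastPositive-∣ k′
    (Invariant⇒fixedBy (Invariant-0 t) (Invariant-0 b))
    (λ fixed-a fixed-b → let ta , ba = fixedBy⇒Invariant fixed-a; tb , bb = fixedBy⇒Invariant fixed-b
                         in Invariant⇒fixedBy (Invariant-+ ta tb) (Invariant-+ ba bb))
    (λ a≡b fixed-a → let ta , ba = fixedBy⇒Invariant fixed-a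
                     in Invariant⇒fixedBy (Invariant-cong a≡b ta) (Invariant-cong a≡b ba))
    (subst T (hasOrder≡isLeastPositive ℓ (t , b)) order)

  fixedBy-K : T (fixedBy (suc k′) (t , b))
  fixedBy-K = Invariant⇒fixedBy (Invariant-cong 0≡K (Invariant-0 t)) (Invariant-cong 0≡K (Invariant-0 b))
    where
    0≡K : 0 % suc k′ ≡ suc k′ % suc k′
    0≡K = sym (n%n≡0 (suc k′))

  order-exists : ∃[ ℓ ] ℓ ∈ divisors (suc k′) × T (hasOrder ℓ (t , b))
  order-exists with ℓ , _ , least ← isLeastPositive-exists k′ fixedBy-K =
    ℓ , ∈-divisors⁺ (order-∣ order) , order
    where
    order : T (hasOrder ℓ (t , b))
    order = subst T (sym (hasOrder≡isLeastPositive ℓ (t , b))) least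

-- Symbols of order D with K = M * D colors

atQuot-∣ : ∀ (f : ℕ → ℕ) {n d} → suc d ∣ n → atQuot f n (suc d) ≡ f (n / suc d)
atQuot-∣ f {n} {d} d∣n rewrite dec-true (suc d ∣? n) d∣n = refl

atQuot-∤ : ∀ (f : ℕ → ℕ) {n d} → ¬ suc d ∣ n → atQuot f n (suc d) ≡ 0
atQuot-∤ f {n} {d} d∤n rewrite dec-false (suc d ∣? n) d∤n = refl

-- A color of K = M * D is numbered D * j + e, that is, color e of the j-th block of D colors.
-- Expansion spreads an entry z_e over all M blocks; restriction keeps the entries of block 0.
module Expansion (d′ m′ : ℕ) where

  D M K K-1 : ℕ
  D = suc d′
  M = suc m′
  K = M * D
  K-1 = d′ + m′ * D

  rem : Fin K → Fin D
  rem = remainder {M} D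

  quo : Fin K → Fin M
  quo = quotient {M} D

  combine-quo-rem : ∀ c → combine (quo c) (rem c) ≡ c
  combine-quo-rem = combine-remQuot {M} D

  toℕ-rem : ∀ c → toℕ (rem c) ≡ toℕ c % D
  toℕ-rem c = sym (begin
    toℕ c % D                           ≡⟨ cong (λ c → toℕ c % D) (combine-quo-rem c) ⟨
    toℕ (combine (quo c) (rem c)) % D   ≡⟨ cong (_% D) (toℕ-combine (quo c) (rem c)) ⟩
    (D * toℕ (quo c) + toℕ (rem c)) % D ≡⟨ %-remove-+ˡ (toℕ (rem c)) (m∣m*n (toℕ (quo c))) ⟩
    toℕ (rem c) % D                     ≡⟨ m<n⇒m%n≡m (toℕ<n (rem c)) ⟩
    toℕ (rem c)                         ∎)
    where open ≡-Reasoning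

  rem-σ^ : ∀ i c → rem (σ^ i c) ≡ σ^ i (rem c)
  rem-σ^ i c = toℕ-injective (begin
    toℕ (rem (σ^ i c))        ≡⟨ toℕ-rem (σ^ i c) ⟩
    toℕ (σ^ i c) % D          ≡⟨ cong (_% D) (toℕ-σ^ i c) ⟩
    (toℕ c + i) % K % D       ≡⟨ m∣n⇒o%n%m≡o%m D K (toℕ c + i) (divides M refl) ⟩
    (toℕ c + i) % D           ≡⟨ %-absorbˡ (toℕ c) i D ⟨
    (toℕ c % D + i) % D       ≡⟨ cong (λ x → (x + i) % D) (toℕ-rem c) ⟨
    (toℕ (rem c) + i) % D     ≡⟨ toℕ-σ^ i (rem c) ⟨
    toℕ (σ^ i (rem c))        ∎)
    where open ≡-Reasoning

  embedColor : Fin D → Fin K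
  embedColor = combine {M} {D} zero

  toℕ-embedColor : ∀ e → toℕ (embedColor e) ≡ toℕ e
  toℕ-embedColor e = toℕ-↑ˡ e (m′ * D)

  σ^-embedColor : ∀ (j : Fin M) (e : Fin D) → σ^ (toℕ j * D) (embedColor e) ≡ combine j e
  σ^-embedColor j e = toℕ-injective (begin
    toℕ (σ^ (toℕ j * D) (embedColor e))           ≡⟨ toℕ-σ^ (toℕ j * D) (embedColor e) ⟩
    (toℕ (embedColor e) + toℕ j * D) % K           ≡⟨ cong (λ x → (x + toℕ j * D) % K) (toℕ-embedColor e) ⟩
    (toℕ e + toℕ j * D) % K                        ≡⟨ cong (_% K) (rearrange (toℕ e) (toℕ j)) ⟩
    (D * toℕ j + toℕ e) % K                        ≡⟨ cong (_% K) (toℕ-combine j e) ⟨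
    toℕ (combine j e) % K                          ≡⟨ m<n⇒m%n≡m (toℕ<n (combine j e)) ⟩
    toℕ (combine j e)                              ∎)
    where
    open ≡-Reasoning
    rearrange : ∀ e j → e + j * D ≡ D * j + e
    rearrange e j = trans (+-comm e (j * D)) (cong (_+ e) (*-comm j D))

  reduce : ColInt K → ColInt D
  reduce (z , c) = z , rem c

  embed : ColInt D → ColInt K
  embed (z , e) = z , embedColor e

  spread : ColInt D × Fin M → ColInt K
  spread ((z , e) , j) = z , combine j e

  reduce-embed : ∀ y → reduce (embed y) ≡ y
  reduce-embed (z , e) = cong (z ,_) (,-injectiveʳ (remQuot-combine {M} {D} zero e))

  reduce-recolor : ∀ i x → reduce (recolor i x) ≡ recolor i (reduce x)
  reduce-recolor i (z , c) = cong (z ,_) (rem-σ^ i c)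

  offset : Fin K → ℕ
  offset c = toℕ (quo c) * D

  recolor-embed-reduce : ∀ x → recolor (offset (proj₂ x)) (embed (reduce x)) ≡ x
  recolor-embed-reduce (z , c) = cong (z ,_) (trans (σ^-embedColor (quo c) (rem c)) (combine-quo-rem c))

  spread-injective : ∀ {p q} → spread p ≡ spread q → p ≡ q
  spread-injective {(z , e) , j} {(z′ , e′) , j′} eq with refl , c≡c′ ← ,-injective eq
    with refl , refl ← ,-injective (trans (sym (remQuot-combine j e))
                                          (trans (cong (remQuot D) c≡c′) (remQuot-combine j′ e′)))
    = refl

  expand : List (ColInt D) → List (ColInt K)
  expand T = sortRow (map spread (cartesianProduct T (allFin M)))

  ∈-expand⁻ : ∀ {T x} → x ∈ expand T → reduce x ∈ T
  ∈-expand⁻ {T} x∈ with ((z , e) , j) , p∈ , refl ← ∈-map⁻ spread (∈-resp-↭ (sortRow-↭ _) x∈) =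
    subst (_∈ T) (sym (cong (z ,_) (,-injectiveʳ (remQuot-combine j e))))
          (proj₁ (∈-cartesianProduct⁻ T (allFin M) p∈))

  ∈-expand⁺ : ∀ {T x} → reduce x ∈ T → x ∈ expand T
  ∈-expand⁺ {T} {z , c} y∈ = ∈-resp-↭ (↭-sym (sortRow-↭ _))
    (subst (_∈ map spread (cartesianProduct T (allFin M))) (cong (z ,_) (combine-quo-rem c))
      (∈-map⁺ spread (∈-cartesianProduct⁺ y∈ (∈-allFin (quo c)))))

  expand-Decreasing : ∀ {T} → Unique T → Decreasing (expand T)
  expand-Decreasing T! =
    sortRow-Decreasing (Unique.map⁺ spread-injective (Unique.cartesianProduct⁺ T! (Unique.allFin⁺ M)))

  restrict : List (ColInt K) → List (ColInt D)
  restrict []            = []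
  restrict ((z , c) ∷ r) with remQuot {M} D c
  ... | zero  , e = (z , e) ∷ restrict r
  ... | suc _ , _ = restrict r

  remQuot≡⇒combine : ∀ {c j e} → remQuot {M} D c ≡ (j , e) → c ≡ combine j e
  remQuot≡⇒combine {c} eq = trans (sym (combine-remQuot {M} D c)) (cong (uncurry combine) eq)

  ∈-restrict⁻ : ∀ {r y} → y ∈ restrict r → embed y ∈ r
  ∈-restrict⁻ {(z , c) ∷ r} y∈ with remQuot {M} D c in eq
  ∈-restrict⁻ {(z , c) ∷ r} (here refl) | zero , e = here (cong (z ,_) (sym (remQuot≡⇒combine eq)))
  ∈-restrict⁻ {(z , c) ∷ r} (there y∈)  | zero , e = there (∈-restrict⁻ y∈)
  ∈-restrict⁻ {(z , c) ∷ r} y∈          | suc _ , _ = there (∈-restrict⁻ y∈)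

  ∈-restrict⁺ : ∀ {r y} → embed y ∈ r → y ∈ restrict r
  ∈-restrict⁺ {(z , c) ∷ r} {y} y∈ with remQuot {M} D c in eq
  ∈-restrict⁺ {(z , c) ∷ r} {y} (here refl) | j , e
    with refl ← trans (sym (remQuot-combine zero (proj₂ y))) eq = here refl
  ∈-restrict⁺ {(z , c) ∷ r} (there y∈) | zero  , e = there (∈-restrict⁺ y∈)
  ∈-restrict⁺ {(z , c) ∷ r} (there y∈) | suc _ , _ = ∈-restrict⁺ y∈

  embed-≺ : ∀ {x y} → embed x ≺ embed y → x ≺ y
  embed-≺ (inj₁ z<z′)          = inj₁ z<z′
  embed-≺ {_ , e} {_ , e′} (inj₂ (z≡z′ , e<e′)) =
    inj₂ (z≡z′ , subst₂ _<_ (toℕ-embedColor e) (toℕ-embedColor e′) e<e′)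

  restrict-Decreasing : ∀ {r} → Decreasing r → Decreasing (restrict r)
  restrict-Decreasing [] = []
  restrict-Decreasing {(z , c) ∷ r} (c≻r ∷ r↓) with remQuot {M} D c in eq
  ... | zero  , e = All.tabulate below ∷ restrict-Decreasing r↓
    where
    below : ∀ {y} → y ∈ restrict r → y ≺ (z , e)
    below y∈ = embed-≺ (subst (embed _ ≺_) (cong (z ,_) (remQuot≡⇒combine eq))
                              (All.lookup c≻r (∈-restrict⁻ y∈)))
  ... | suc _ , _ = restrict-Decreasing r↓

  Invariant-expand⁺ : ∀ {i T} → Invariant i T → Invariant i (expand T)
  Invariant-expand⁺ {i} {T} inv {x} x∈ =
    ∈-expand⁺ (subst (_∈ T) (sym (reduce-recolor i x)) (inv (∈-expand⁻ x∈)))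

  Invariant-expand⁻ : ∀ {i T} → Invariant i (expand T) → Invariant i T
  Invariant-expand⁻ {i} {T} inv {y} y∈ =
    subst (_∈ T) (trans (reduce-recolor i (embed y)) (cong (recolor i) (reduce-embed y)))
      (∈-expand⁻ {x = recolor i (embed y)}
        (inv (∈-expand⁺ {x = embed y} (subst (_∈ T) (sym (reduce-embed y)) y∈))))

  restrict-expand : ∀ {T} → Decreasing T → restrict (expand T) ≡ T
  restrict-expand {T} T↓ = Decreasing-≡ (restrict-Decreasing (expand-Decreasing (Decreasing⇒Unique T↓))) T↓
    (λ {y} y∈ → subst (_∈ T) (reduce-embed y) (∈-expand⁻ (∈-restrict⁻ y∈)))
    (λ {y} y∈ → ∈-restrict⁺ (∈-expand⁺ (subst (_∈ T) (sym (reduce-embed y)) y∈)))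

  module _ {t : List (ColInt K)} (inv : Invariant D t) where

    embed-reduce-∈⁻ : ∀ {x} → embed (reduce x) ∈ t → x ∈ t
    embed-reduce-∈⁻ {x} x∈ = subst (_∈ t) (recolor-embed-reduce x) (Invariant-* (toℕ (quo (proj₂ x))) inv x∈)

    embed-reduce-∈⁺ : ∀ {x} → x ∈ t → embed (reduce x) ∈ t
    embed-reduce-∈⁺ {x} x∈ = subst (_∈ t) undo (invariant x∈)
      where
      a : ℕ
      a = offset (proj₂ x)
      invariant : Invariant (a * K-1) t
      invariant = subst (λ i → Invariant i t) (*-comm K-1 a)
                        (Invariant-* K-1 (Invariant-* (toℕ (quo (proj₂ x))) inv))
      undo : recolor (a * K-1) x ≡ embed (reduce x)
      undo = trans (cong (recolor (a * K-1)) (sym (recolor-embed-reduce x))) (recolor-inverseˡ a (embed (reduce x)))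

    expand-restrict : Decreasing t → expand (restrict t) ≡ t
    expand-restrict t↓ = Decreasing-≡ (expand-Decreasing (Decreasing⇒Unique (restrict-Decreasing t↓))) t↓
      (embed-reduce-∈⁻ ∘ ∈-restrict⁻ ∘ ∈-expand⁻)
      (∈-expand⁺ ∘ ∈-restrict⁺ ∘ embed-reduce-∈⁺)

  length-expand : ∀ T → length (expand T) ≡ M * length T
  length-expand T = begin
    length (expand T)            ≡⟨ ↭-length (sortRow-↭ (map spread pairs)) ⟩
    length (map spread pairs)    ≡⟨ length-map spread pairs ⟩
    length pairs                 ≡⟨ length-cartesianProduct T (allFin M) ⟩
    length (allFin M) * length T ≡⟨ cong (_* length T) (length-tabulate {n = M} id) ⟩
    M * length T                 ∎
    where
    open ≡-Reasoning
    pairs : List (ColInt D × Fin M)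
    pairs = cartesianProduct T (allFin M)

  rowValues-expand : ∀ T → rowValues (expand T) ≡ M * rowValues T
  rowValues-expand T = begin
    rowValues (expand T)                ≡⟨ rowValues-↭ (sortRow-↭ (map spread pairs)) ⟩
    rowValues (map spread pairs)        ≡⟨ cong sum (map-∘ pairs) ⟨
    sum (map (proj₁ ∘ proj₁) pairs)     ≡⟨ sum-map-proj₁-cartesianProduct proj₁ T (allFin M) ⟩
    length (allFin M) * rowValues T     ≡⟨ cong (_* rowValues T) (length-tabulate {n = M} id) ⟩
    M * rowValues T                     ∎
    where
    open ≡-Reasoning
    pairs : List (ColInt D × Fin M)
    pairs = cartesianProduct T (allFin M)

  restrictS : Symbol K → Symbol D
  restrictS (t , b) = restrict t , restrict b

  expandS : Symbol D → Symbol K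
  expandS (t , b) = expand t , expand b

  size-expandS : ∀ s → size (expandS s) ≡ M * size s
  size-expandS (t , b) = begin
    length (expand t) + (rowValues (expand t) + rowValues (expand b))
      ≡⟨ cong₂ _+_ (length-expand t) (cong₂ _+_ (rowValues-expand t) (rowValues-expand b)) ⟩
    M * length t + (M * rowValues t + M * rowValues b)
      ≡⟨ cong (M * length t +_) (*-distribˡ-+ M (rowValues t) (rowValues b)) ⟨
    M * length t + M * (rowValues t + rowValues b)
      ≡⟨ *-distribˡ-+ M (length t) _ ⟨
    M * size (t , b) ∎
    where open ≡-Reasoning

  expandS-IsSymbol : ∀ {n s} → IsSymbol n s → IsSymbol (M * n) (expandS s)
  expandS-IsSymbol {s = t , b} symbol = record
    { top↓    = expand-Decreasing (Decreasing⇒Unique top↓)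
    ; bottom↓ = expand-Decreasing (Decreasing⇒Unique bottom↓)
    ; columns = trans (length-expand t) (trans (cong (M *_) columns) (sym (length-expand b)))
    ; size≡   = trans (size-expandS (t , b)) (cong (M *_) size≡)
    }
    where open IsSymbol symbol

  hasOrder-expandS : ∀ {t b} → Decreasing t → Decreasing b →
    ∀ ℓ → hasOrder ℓ (expandS (t , b)) ≡ hasOrder ℓ (t , b)
  hasOrder-expandS {t} {b} t↓ b↓ ℓ = begin
    hasOrder ℓ (expandS (t , b))                              ≡⟨ hasOrder≡isLeastPositive ℓ (expandS (t , b)) ⟩
    isLeastPositive (λ i → fixedBy i (expandS (t , b))) ℓ     ≡⟨ isLeastPositive-cong fixedBy-expandS ℓ ⟩
    isLeastPositive (λ i → fixedBy i (t , b)) ℓ               ≡⟨ hasOrder≡isLeastPositive ℓ (t , b) ⟨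
    hasOrder ℓ (t , b)                                        ∎
    where
    open ≡-Reasoning
    et↓ : Decreasing (expand t)
    et↓ = expand-Decreasing (Decreasing⇒Unique t↓)
    eb↓ : Decreasing (expand b)
    eb↓ = expand-Decreasing (Decreasing⇒Unique b↓)
    fixedBy-expandS : ∀ i → fixedBy i (expandS (t , b)) ≡ fixedBy i (t , b)
    fixedBy-expandS i = T-extensional
      (λ fixed → let it , ib = fixedBy⇒Invariant et↓ eb↓ fixed
                 in Invariant⇒fixedBy t↓ b↓ (Invariant-expand⁻ it) (Invariant-expand⁻ ib))
      (λ fixed → let it , ib = fixedBy⇒Invariant t↓ b↓ fixed
                 in Invariant⇒fixedBy et↓ eb↓ (Invariant-expand⁺ it) (Invariant-expand⁺ ib))

  module _ {n} {s : Symbol K} (symbol : IsSymbol n s) (order : T (hasOrder D s)) where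
    open IsSymbol symbol

    expandS-restrictS : expandS (restrictS s) ≡ s
    expandS-restrictS with it , ib ← fixedBy⇒Invariant top↓ bottom↓ (hasOrder⇒fixedBy D s order) =
      cong₂ _,_ (expand-restrict it top↓) (expand-restrict ib bottom↓)

    M*size-restrictS : M * size (restrictS s) ≡ n
    M*size-restrictS = trans (sym (size-expandS (restrictS s))) (trans (cong size expandS-restrictS) size≡)

    order-D⇒M∣n : M ∣ n
    order-D⇒M∣n = divides (size (restrictS s)) (trans (sym M*size-restrictS) (*-comm M _))

    restrictS-IsSymbol : IsSymbol (size (restrictS s)) (restrictS s)
    restrictS-IsSymbol = record
      { top↓    = restrict-Decreasing top↓
      ; bottom↓ = restrict-Decreasing bottom↓
      ; columns = *-cancelˡ-≡ _ _ M (begin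
          M * length (restrict (proj₁ s))         ≡⟨ length-expand (restrict (proj₁ s)) ⟨
          length (proj₁ (expandS (restrictS s)))  ≡⟨ cong (length ∘ proj₁) expandS-restrictS ⟩
          length (proj₁ s)                        ≡⟨ columns ⟩
          length (proj₂ s)                        ≡⟨ cong (length ∘ proj₂) expandS-restrictS ⟨
          length (proj₂ (expandS (restrictS s)))  ≡⟨ length-expand (restrict (proj₂ s)) ⟩
          M * length (restrict (proj₂ s))         ∎)
      ; size≡   = refl
      }
      where open ≡-Reasoning

    restrictS-hasOrder : T (hasOrder D (restrictS s))
    restrictS-hasOrder = subst T (trans (cong (hasOrder D) (sym expandS-restrictS))
      (hasOrder-expandS (restrict-Decreasing top↓) (restrict-Decreasing bottom↓) D)) order

  count-of-order-D : ∀ n → count (symbolOfOrder n D) (candidates K n) ≡ atQuot (cφbar D) n M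
  count-of-order-D n with M ∣? n
  ... | no M∤n =
    trans (count≡0 _ (candidates K n) (λ s t → M∤n (uncurry order-D⇒M∣n (symbolOfOrder⇒ s t))))
          (sym (atQuot-∤ (cφbar D) M∤n))
  ... | yes M∣n =
    trans (count-bijection _ _ restrictS expandS (candidates-unique K n) (candidates-unique D n′) to from)
          (sym (atQuot-∣ (cφbar D) M∣n))
    where
    n′ : ℕ
    n′ = n / M
    M*n′≡n : M * n′ ≡ n
    M*n′≡n = m*[n/m]≡n M∣n
    to : ∀ {x} → x ∈ candidates K n → T (symbolOfOrder n D x) →
         restrictS x ∈ candidates D n′ × T (symbolOfOrder n′ D (restrictS x)) × expandS (restrictS x) ≡ x
    to {x} _ t with symbol , order ← symbolOfOrder⇒ x t =
      IsSymbol⇒∈candidates symbol′ , symbolOfOrder⇐ symbol′ (restrictS-hasOrder symbol order) ,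
      expandS-restrictS symbol order
      where
      symbol′ : IsSymbol n′ (restrictS x)
      symbol′ = subst (λ m → IsSymbol m (restrictS x))
                  (*-cancelˡ-≡ _ _ M (trans (M*size-restrictS symbol order) (sym M*n′≡n)))
                  (restrictS-IsSymbol symbol order)
    from : ∀ {y} → y ∈ candidates D n′ → T (symbolOfOrder n′ D y) →
           expandS y ∈ candidates K n × T (symbolOfOrder n D (expandS y)) × restrictS (expandS y) ≡ y
    from {t , b} _ u with symbol , order ← symbolOfOrder⇒ (t , b) u =
      IsSymbol⇒∈candidates symbol′ , symbolOfOrder⇐ symbol′ order′ , cong₂ _,_ (restrict-expand top↓) (restrict-expand bottom↓)
      where
      open IsSymbol symbol
      symbol′ : IsSymbol n (expandS (t , b))
      symbol′ = subst (λ m → IsSymbol m (expandS (t , b))) M*n′≡n (expandS-IsSymbol symbol)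
      order′ : T (hasOrder D (expandS (t , b)))
      order′ = subst T (sym (hasOrder-expandS top↓ bottom↓ D)) order

-- The divisor sums

cφ-split-by-order : ∀ k′ n →
  cφ (suc k′) n ≡ divisorSum (suc k′) (λ ℓ → count (symbolOfOrder n ℓ) (candidates (suc k′) n))
cφ-split-by-order k′ n =
  count-partition (isSymbolOf n) hasOrder (divisors-unique (suc k′)) labelled (candidates (suc k′) n)
  where
  labelled : ∀ s → T (isSymbolOf n s) →
             ∃[ o ] o ∈ divisors (suc k′) × T (hasOrder o s) × (∀ ℓ → T (hasOrder ℓ s) → ℓ ≡ o)
  labelled s symbolOf = let o , o∈ , order = order-exists top↓ bottom↓ in
    o , o∈ , order , λ ℓ order′ → order-unique s order′ order
    where open IsSymbol (isSymbolOf⇒IsSymbol s symbolOf)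

count-of-order : ∀ k′ n {ℓ} → ℓ ∈ divisors (suc k′) →
  count (symbolOfOrder n ℓ) (candidates (suc k′) n) ≡ atQuot (cφbar ℓ) n (quot (suc k′) ℓ)
count-of-order k′ n {zero}   ℓ∈ with () ← 0∣⇒≡0 (∈-divisors⁻ {suc k′} ℓ∈)
count-of-order k′ n {suc l′} ℓ∈ with ∈-divisors⁻ {suc k′} ℓ∈
... | divides (suc m′) refl =
  trans (Expansion.count-of-order-D l′ m′ n)
        (cong (atQuot (cφbar (suc l′)) n) (sym (m*n/n≡m (suc m′) (suc l′))))

quot-involutive : ∀ k′ {ℓ} → ℓ ∈ divisors (suc k′) →
  quot (suc k′) ℓ ∈ divisors (suc k′) × quot (suc k′) (quot (suc k′) ℓ) ≡ ℓ
quot-involutive k′ {zero}   ℓ∈ with () ← 0∣⇒≡0 (∈-divisors⁻ {suc k′} ℓ∈)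
quot-involutive k′ {suc l′} ℓ∈ with ∈-divisors⁻ {suc k′} ℓ∈
... | divides (suc m′) refl =
  subst (λ q → q ∈ divisors K × quot K q ≡ suc l′) (sym (m*n/n≡m (suc m′) (suc l′)))
    (∈-divisors⁺ (divides (suc l′) K≡l*m) , trans (cong (_/ suc m′) K≡l*m) (m*n/n≡m (suc l′) (suc m′)))
  where
  K : ℕ
  K = suc m′ * suc l′
  K≡l*m : K ≡ suc l′ * suc m′
  K≡l*m = *-comm (suc m′) (suc l′)

theorem7p2 : (k n : ℕ) → 1 ≤ k → 1 ≤ n →
    (cφ k n ≡ divisorSum k (λ ℓ → atQuot (cφbar ℓ) n (quot k ℓ)))
    × (divisorSum k (λ ℓ → atQuot (cφbar ℓ) n (quot k ℓ))
       ≡ divisorSum k (λ ℓ → atQuot (cφbar (quot k ℓ)) n ℓ))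
theorem7p2 (suc k′) n _ _ = by-order , reindexed
  where
  K : ℕ
  K = suc k′
  by-order : cφ K n ≡ divisorSum K (λ ℓ → atQuot (cφbar ℓ) n (quot K ℓ))
  by-order = trans (cφ-split-by-order k′ n) (cong sum (map-cong-local (All.tabulate (count-of-order k′ n))))
  reindexed : divisorSum K (λ ℓ → atQuot (cφbar ℓ) n (quot K ℓ))
            ≡ divisorSum K (λ ℓ → atQuot (cφbar (quot K ℓ)) n ℓ)
  reindexed = sum-map-involution _ _ (quot K) (divisors-unique K) (quot-involutive k′)
    (λ {ℓ} ℓ∈ → cong (atQuot (cφbar (quot K ℓ)) n) (proj₂ (quot-involutive k′ ℓ∈)))
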